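{- Let $u_n=(-1)^{s_2(n)}$, where $s_2(n)$ is the sum of the binary digits of $n$. Then $$\prod_{n=0}^\infty\left(\frac{(4n+3)(2n+2)}{(4n+5)(2n+3)}\right)^{u_n}=\frac{1}{\sqrt 2}.$$ -}

module Defs where

open import Data.Nat using (ℕ; zero; suc; _+_; _*_; _%_; _/_; _≡ᵇ_)
open import Data.Integer using (+_)
open import Data.Rational using (ℚ; 0ℚ; 1ℚ; _<_; _≤_) renaming (_+_ to _+ℚ_; _*_ to _*ℚ_; _-_ to _-ℚ_; _/_ to _÷_)
open import Data.Bool using (Bool; true; false; if_then_else_)
open import Data.Product using (_×_)
open import Data.Sum using (_⊎_)

-- s₂ with fuel: sum of the binary digits; fuel m is enough for input m
-- (each step halves the argument).
s2-fuel : ℕ → ℕ → ℕ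
s2-fuel zero    m = zero
s2-fuel (suc f) m = m % 2 + s2-fuel f (m / 2)

s2 : ℕ → ℕ
s2 n = s2-fuel n n

uIsPlusOne : ℕ → Bool
uIsPlusOne n = (s2 n % 2) ≡ᵇ 0

factor : ℕ → ℚ
factor n = (+ ((3 + 4 * n) * (2 + 2 * n))) ÷ ((5 + 4 * n) * (3 + 2 * n))

factorInv : ℕ → ℚ
factorInv n = (+ ((5 + 4 * n) * (3 + 2 * n))) ÷ ((3 + 4 * n) * (2 + 2 * n))

term : ℕ → ℚ
term n = if uIsPlusOne n then factor n else factorInv n

partialProduct : ℕ → ℚ
partialProduct zero    = 1ℚ
partialProduct (suc N) = partialProduct N *ℚ term N

two : ℚ
two = (+ 2) ÷ 1

-- Dedekind cut of the real number 1/√2, for rationals q: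
-- q < 1/√2  iff  q ≤ 0 or 2q² < 1
BelowInvSqrt2 : ℚ → Set
BelowInvSqrt2 q = (q ≤ 0ℚ) ⊎ ((two *ℚ (q *ℚ q)) < 1ℚ)

-- 1/√2 < q  iff  0 < q and 1 < 2q²
AboveInvSqrt2 : ℚ → Set
AboveInvSqrt2 q = (0ℚ < q) × (1ℚ < (two *ℚ (q *ℚ q)))

module Submission where

-- An exact identity:  2 P(N)² = ∏_{N ≤ n < 2N} d(n)^{u_n}  with  d(n) = (n+1)(2n+3)² / (n(2n+2)²).
-- Every factor in sight telescopes into quotients r(m) = m/(m+1), and the Thue–Morse recurrences
-- u_{2n} = u_n, u_{2n+1} = −u_n fold a product over [0, 2N) into a product over [0, N) of ratios of
-- consecutive factors; comparing the two ways of folding gives the identity.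
--
-- An estimate:  for h decreasing with h ≥ 1, the signed product of h over a block [N, 2N) lies
-- between h(N)⁻² and h(N)², since after folding into pairs it becomes a product of ratios that
-- telescopes.  As d(N) ≤ (N+4)/N, the partial products satisfy 2P(N)² → 1 with an explicit rate,
-- which gives the Dedekind-cut formulation of the theorem.

module ThueMorse where
  open import Data.Nat using (zero; suc; _+_; _*_; _%_; _/_; _≤_; _<_; _≡ᵇ_; s≤s; z≤n; s≤s⁻¹)
  open import Data.Nat.Properties using (≤-trans; ≤-refl; +-identityʳ; *-comm)
  open import Data.Nat.DivMod
  open import Data.Bool using (not)
  open import Relation.Binary.PropositionalEquality
  open import Defs using (s2-fuel; s2; uIsPlusOne)

  digit-%2 : ∀ q r → r < 2 → (r + q * 2) % 2 ≡ r
  digit-%2 q r r<2 = trans ([m+kn]%n≡m%n r q 2) (m<n⇒m%n≡m r<2)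

  digit-/2 : ∀ q r → r < 2 → (r + q * 2) / 2 ≡ q
  digit-/2 q r r<2 = begin
      (r + q * 2) / 2     ≡⟨ +-distrib-/ r (q * 2) digits<2 ⟩
      r / 2 + q * 2 / 2   ≡⟨ cong₂ _+_ (m<n⇒m/n≡0 r<2) (m*n/n≡m q 2) ⟩
      q                   ∎
    where
    open ≡-Reasoning
    digits<2 : r % 2 + q * 2 % 2 < 2
    digits<2 = subst₂ (λ a b → a + b < 2) (sym (m<n⇒m%n≡m r<2)) (sym (m*n%n≡0 q 2))
                 (subst (_< 2) (sym (+-identityʳ r)) r<2)

  half-suc≤ : ∀ m → suc m / 2 ≤ m
  half-suc≤ m = s≤s⁻¹ (m/n<m (suc m) 2 (s≤s (s≤s z≤n)))

  s2-fuel-irrelevant : ∀ f g m → m ≤ f → m ≤ g → s2-fuel f m ≡ s2-fuel g m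
  s2-fuel-irrelevant f g zero _ _ = trans (no-digits f) (sym (no-digits g))
    where
    no-digits : ∀ f → s2-fuel f 0 ≡ 0
    no-digits zero    = refl
    no-digits (suc f) = no-digits f
  s2-fuel-irrelevant (suc f) (suc g) (suc m) m<f m<g =
    cong (suc m % 2 +_) (s2-fuel-irrelevant f g (suc m / 2) (≤-trans (half-suc≤ m) (s≤s⁻¹ m<f))
                                                          (≤-trans (half-suc≤ m) (s≤s⁻¹ m<g)))

  s2-step : ∀ m → 0 < m → s2 m ≡ m % 2 + s2 (m / 2)
  s2-step (suc m) _ = cong (suc m % 2 +_) (s2-fuel-irrelevant m (suc m / 2) (suc m / 2) (half-suc≤ m) ≤-refl)

  s2-digit : ∀ q r → r < 2 → 0 < r + q * 2 → s2 (r + q * 2) ≡ r + s2 q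
  s2-digit q r r<2 pos = trans (s2-step (r + q * 2) pos)
                               (cong₂ _+_ (digit-%2 q r r<2) (cong s2 (digit-/2 q r r<2)))

  double≡*2 : ∀ n → n + n ≡ n * 2
  double≡*2 n = trans (cong (n +_) (sym (+-identityʳ n))) (*-comm 2 n)

  s2-double : ∀ n → s2 (n + n) ≡ s2 n
  s2-double zero    = refl
  s2-double (suc n) = trans (cong s2 (double≡*2 (suc n))) (s2-digit (suc n) 0 (s≤s z≤n) (s≤s z≤n))

  s2-double+1 : ∀ n → s2 (suc (n + n)) ≡ suc (s2 n)
  s2-double+1 n = trans (cong (λ m → s2 (suc m)) (double≡*2 n)) (s2-digit n 1 (s≤s (s≤s z≤n)) (s≤s z≤n))

  even-suc : ∀ s → (suc s % 2 ≡ᵇ 0) ≡ not (s % 2 ≡ᵇ 0)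
  even-suc zero          = refl
  even-suc (suc zero)    = refl
  even-suc (suc (suc s)) = even-suc s

  sign-double : ∀ n → uIsPlusOne (n + n) ≡ uIsPlusOne n
  sign-double n = cong (λ s → s % 2 ≡ᵇ 0) (s2-double n)

  sign-double+1 : ∀ n → uIsPlusOne (suc (n + n)) ≡ not (uIsPlusOne n)
  sign-double+1 n = trans (cong (λ s → s % 2 ≡ᵇ 0) (s2-double+1 n)) (even-suc (s2 n))

module Fraction where
  open import Level using (0ℓ)
  open import Data.Nat using (ℕ; _+_; _*_; _≤_; NonZero)
  open import Data.Nat.Properties
  open import Data.Nat.Tactic.RingSolver using (solve-∀)
  open import Data.Bool using (Bool; true; false; not)
  open import Algebra.Bundles using (CommutativeMonoid)
  open import Data.Product using (_,_)
  open import Relation.Binary.Bundles using (Setoid; Preorder)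
  open import Relation.Binary.Structures using (IsEquivalence; IsPreorder)
  open import Relation.Binary.PropositionalEquality

  record Frac : Set where
    constructor _÷_
    field
      num den : ℕ
      .{{num≢0}} : NonZero num
      .{{den≢0}} : NonZero den
  open Frac public

  infix  5 _÷_
  infixl 7 _·_
  infix  9 _⁻¹
  infix  4 _≈_ _≼_

  1F : Frac
  1F = 1 ÷ 1

  _·_ : Frac → Frac → Frac
  (a ÷ b) · (c ÷ d) = _÷_ (a * c) (b * d) {{m*n≢0 a c}} {{m*n≢0 b d}}

  _⁻¹ : Frac → Frac
  (a ÷ b) ⁻¹ = b ÷ a

  frac-≡ : ∀ {x y} → num x ≡ num y → den x ≡ den y → x ≡ y
  frac-≡ {a ÷ b} {.a ÷ .b} refl refl = refl

  ·-assoc : ∀ x y z → x · y · z ≡ x · (y · z)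
  ·-assoc x y z = frac-≡ (*-assoc (num x) _ _) (*-assoc (den x) _ _)

  ·-comm : ∀ x y → x · y ≡ y · x
  ·-comm x y = frac-≡ (*-comm (num x) _) (*-comm (den x) _)

  ·-identityˡ : ∀ x → 1F · x ≡ x
  ·-identityˡ x = frac-≡ (*-identityˡ _) (*-identityˡ _)

  ·-identityʳ : ∀ x → x · 1F ≡ x
  ·-identityʳ x = frac-≡ (*-identityʳ _) (*-identityʳ _)

  ·-commutativeMonoid : CommutativeMonoid 0ℓ 0ℓ
  ·-commutativeMonoid = record
    { isCommutativeMonoid = record
      { isMonoid = record
        { isSemigroup = record
          { isMagma = record { isEquivalence = isEquivalence ; ∙-cong = cong₂ _·_ }
          ; assoc = ·-assoc }
        ; identity = ·-identityˡ , ·-identityʳ }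
      ; comm = ·-comm } }

  open import Algebra.Solver.CommutativeMonoid ·-commutativeMonoid using (solve; _⊜_; _⊕_)

  ·-interchange : ∀ x y z w → x · y · (z · w) ≡ x · z · (y · w)
  ·-interchange = solve 4 (λ x y z w → (x ⊕ y) ⊕ (z ⊕ w) ⊜ (x ⊕ z) ⊕ (y ⊕ w)) refl

  private
    swap : ∀ a b c → a * b * c ≡ a * c * b
    swap = solve-∀

    interchange : ∀ a b c d → a * b * (c * d) ≡ a * c * (b * d)
    interchange = solve-∀

  record _≈_ (x y : Frac) : Set where
    constructor mk≈
    field cross-≡ : num x * den y ≡ num y * den x

  ≈-isEquivalence : IsEquivalence _≈_
  ≈-isEquivalence = record
    { refl  = mk≈ refl
    ; sym   = λ (mk≈ p) → mk≈ (sym p)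
    ; trans = trans≈ }
    where
    trans≈ : ∀ {x y z} → x ≈ y → y ≈ z → x ≈ z
    trans≈ {a ÷ b} {c ÷ d} {e ÷ f} (mk≈ p) (mk≈ q) = mk≈ (*-cancelʳ-≡ (a * f) (e * b) d (begin
        a * f * d ≡⟨ swap a f d ⟩
        a * d * f ≡⟨ cong (_* f) p ⟩
        c * b * f ≡⟨ swap c b f ⟩
        c * f * b ≡⟨ cong (_* b) q ⟩
        e * d * b ≡⟨ swap e d b ⟩
        e * b * d ∎))
      where open ≡-Reasoning

  ≈-setoid : Setoid 0ℓ 0ℓ
  ≈-setoid = record { isEquivalence = ≈-isEquivalence }

  open IsEquivalence ≈-isEquivalence public
    using () renaming (refl to ≈-refl; trans to ≈-trans; reflexive to ≡⇒≈)

  ·-cong : ∀ {x y z w} → x ≈ y → z ≈ w → x · z ≈ y · w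
  ·-cong {a ÷ b} {c ÷ d} {e ÷ f} {g ÷ h} (mk≈ p) (mk≈ q) = mk≈ (begin
      a * e * (d * h) ≡⟨ interchange a e d h ⟩
      a * d * (e * h) ≡⟨ cong₂ _*_ p q ⟩
      c * b * (g * f) ≡⟨ interchange c b g f ⟩
      c * g * (b * f) ∎)
    where open ≡-Reasoning

  ⁻¹-cong : ∀ {x y} → x ≈ y → x ⁻¹ ≈ y ⁻¹
  ⁻¹-cong {a ÷ b} {c ÷ d} (mk≈ p) = mk≈ (trans (*-comm b c) (trans (sym p) (*-comm a d)))

  ·-inverseʳ : ∀ x → x · x ⁻¹ ≈ 1F
  ·-inverseʳ (a ÷ b) = mk≈ (trans (*-identityʳ (a * b)) (trans (*-comm a b) (sym (*-identityˡ (b * a)))))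

  ·-⁻¹-cancelʳ : ∀ x y → x · y ⁻¹ · y ≈ x
  ·-⁻¹-cancelʳ x y = ≈-trans (≡⇒≈ (trans (·-assoc x (y ⁻¹) y) (cong (x ·_) (·-comm (y ⁻¹) y))))
                     (≈-trans (·-cong (≈-refl {x}) (·-inverseʳ y)) (≡⇒≈ (·-identityʳ x)))

  record _≼_ (x y : Frac) : Set where
    constructor mk≼
    field cross-≤ : num x * den y ≤ num y * den x

  ≼-isPreorder : IsPreorder _≈_ _≼_
  ≼-isPreorder = record
    { isEquivalence = ≈-isEquivalence
    ; reflexive     = λ (mk≈ p) → mk≼ (≤-reflexive p)
    ; trans         = trans≼ }
    where
    trans≼ : ∀ {x y z} → x ≼ y → y ≼ z → x ≼ z
    trans≼ {a ÷ b} {c ÷ d} {e ÷ f} (mk≼ p) (mk≼ q) = mk≼ (*-cancelʳ-≤ (a * f) (e * b) d (begin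
        a * f * d ≡⟨ swap a f d ⟩
        a * d * f ≤⟨ *-monoˡ-≤ f p ⟩
        c * b * f ≡⟨ swap c b f ⟩
        c * f * b ≤⟨ *-monoˡ-≤ b q ⟩
        e * d * b ≡⟨ swap e d b ⟩
        e * b * d ∎))
      where open ≤-Reasoning

  ≼-preorder : Preorder 0ℓ 0ℓ 0ℓ
  ≼-preorder = record { isPreorder = ≼-isPreorder }

  open IsPreorder ≼-isPreorder public
    using () renaming (refl to ≼-refl; reflexive to ≈⇒≼; trans to ≼-trans)

  ·-mono-≼ : ∀ {x y z w} → x ≼ y → z ≼ w → x · z ≼ y · w
  ·-mono-≼ {a ÷ b} {c ÷ d} {e ÷ f} {g ÷ h} (mk≼ p) (mk≼ q) = mk≼ (begin
      a * e * (d * h) ≡⟨ interchange a e d h ⟩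
      a * d * (e * h) ≤⟨ *-mono-≤ p q ⟩
      c * b * (g * f) ≡⟨ interchange c b g f ⟩
      c * g * (b * f) ∎)
    where open ≤-Reasoning

  ⁻¹-antitone : ∀ {x y} → x ≼ y → y ⁻¹ ≼ x ⁻¹
  ⁻¹-antitone {a ÷ b} {c ÷ d} (mk≼ p) = mk≼ (subst₂ _≤_ (*-comm a d) (*-comm c b) p)

  -- Proving a ≤ between explicit quotients from a polynomial identity with nonnegative remainder.
  ÷-≼ : ∀ {a b c e} rem .{{_ : NonZero a}} .{{_ : NonZero b}} .{{_ : NonZero c}} .{{_ : NonZero e}} →
        a * e + rem ≡ c * b → a ÷ b ≼ c ÷ e
  ÷-≼ {a} {b} {c} {e} rem eq = mk≼ (subst (a * e ≤_) eq (m≤m+n (a * e) rem))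

  _^[_] : Frac → Bool → Frac
  x ^[ true ]  = x
  x ^[ false ] = x ⁻¹

  ^-distrib-· : ∀ s x y → (x · y) ^[ s ] ≡ x ^[ s ] · y ^[ s ]
  ^-distrib-· true  x y = refl
  ^-distrib-· false x y = refl

  ^-⁻¹ : ∀ s x → (x ⁻¹) ^[ s ] ≡ (x ^[ s ]) ⁻¹
  ^-⁻¹ true  x = refl
  ^-⁻¹ false x = refl

  ^-not : ∀ s x → x ^[ not s ] ≡ (x ⁻¹) ^[ s ]
  ^-not true  x = refl
  ^-not false x = refl

  ^-cong : ∀ s {x y} → x ≈ y → x ^[ s ] ≈ y ^[ s ]
  ^-cong true  x≈y = x≈y
  ^-cong false x≈y = ⁻¹-cong x≈y

  ^-≼ : ∀ s {x} → 1F ≼ x → x ^[ s ] ≼ x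
  ^-≼ true  1≼x = ≼-refl
  ^-≼ false 1≼x = ≼-trans (⁻¹-antitone 1≼x) 1≼x

  ^-≽ : ∀ s {x} → 1F ≼ x → x ⁻¹ ≼ x ^[ s ]
  ^-≽ true  1≼x = ≼-trans (⁻¹-antitone 1≼x) 1≼x
  ^-≽ false 1≼x = ≼-refl

  ≼-·-grow : ∀ {x y} → 1F ≼ y → x ≼ x · y
  ≼-·-grow {x} {y} 1≼y =
    subst (_≼ x · y) (·-identityʳ x) (·-mono-≼ (≼-refl {x}) 1≼y)

  ·-cancelˡ : ∀ x {y z} → x · y ≈ x · z → y ≈ z
  ·-cancelˡ x {y} {z} xy≈xz = begin
      y                  ≈⟨ ·-⁻¹-cancelʳ y x ⟨
      y · x ⁻¹ · x       ≡⟨ trans (·-comm (y · x ⁻¹) x) (sym (·-assoc x y (x ⁻¹))) ⟩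
      x · y · x ⁻¹       ≈⟨ ·-cong xy≈xz (≈-refl {x ⁻¹}) ⟩
      x · z · x ⁻¹       ≡⟨ trans (·-assoc x z (x ⁻¹)) (·-comm x (z · x ⁻¹)) ⟩
      z · x ⁻¹ · x       ≈⟨ ·-⁻¹-cancelʳ z x ⟩
      z                  ∎
    where open import Relation.Binary.Reasoning.Setoid ≈-setoid

  ·≈1⇒≈⁻¹ : ∀ {x y} → x · y ≈ 1F → x ≈ y ⁻¹
  ·≈1⇒≈⁻¹ {x} {y} xy≈1 = begin
      x                  ≈⟨ ·-⁻¹-cancelʳ x (y ⁻¹) ⟨
      x · y · y ⁻¹       ≈⟨ ·-cong xy≈1 (≈-refl {y ⁻¹}) ⟩
      1F · y ⁻¹          ≡⟨ ·-identityˡ (y ⁻¹) ⟩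
      y ⁻¹               ∎
    where open import Relation.Binary.Reasoning.Setoid ≈-setoid

module SignedProducts where
  open import Data.Nat using (ℕ; zero; suc; _+_; _≤_)
  open import Data.Nat.Properties using (+-suc; +-identityʳ; +-comm; ≤-refl; <⇒≤)
  open import Data.Bool using (Bool; not)
  open import Data.Product using (_×_; _,_; ∃)
  open import Data.Sum using (_⊎_; inj₁; inj₂)
  open import Relation.Binary.PropositionalEquality
  open Fraction

  even-or-odd : ∀ N → ∃ (λ m → N ≡ m + m) ⊎ ∃ (λ m → N ≡ suc (m + m))
  even-or-odd zero = inj₁ (0 , refl)
  even-or-odd (suc N) with even-or-odd N
  ... | inj₁ (m , refl) = inj₂ (m , refl)
  ... | inj₂ (m , refl) = inj₁ (suc m , cong suc (sym (+-suc m m)))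

  ∏ : (ℕ → Frac) → ℕ → ℕ → Frac
  ∏ h a zero    = 1F
  ∏ h a (suc L) = h a · ∏ h (suc a) L

  pairRatio : (ℕ → Frac) → ℕ → Frac
  pairRatio h n = h (n + n) · h (suc (n + n)) ⁻¹

  module WithSign (σ : ℕ → Bool) where

    ∏± : (ℕ → Frac) → ℕ → ℕ → Frac
    ∏± h a zero    = 1F
    ∏± h a (suc L) = h a ^[ σ a ] · ∏± h (suc a) L

    ∏±-· : ∀ h g a L → ∏± (λ n → h n · g n) a L ≡ ∏± h a L · ∏± g a L
    ∏±-· h g a zero    = refl
    ∏±-· h g a (suc L) = begin
        (h a · g a) ^[ σ a ] · ∏± (λ n → h n · g n) (suc a) L
          ≡⟨ cong₂ _·_ (^-distrib-· (σ a) (h a) (g a)) (∏±-· h g (suc a) L) ⟩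
        h a ^[ σ a ] · g a ^[ σ a ] · (∏± h (suc a) L · ∏± g (suc a) L)
          ≡⟨ ·-interchange (h a ^[ σ a ]) (g a ^[ σ a ]) (∏± h (suc a) L) (∏± g (suc a) L) ⟩
        ∏± h a (suc L) · ∏± g a (suc L) ∎
      where open ≡-Reasoning

    ∏±-⁻¹ : ∀ h a L → ∏± (λ n → h n ⁻¹) a L ≡ (∏± h a L) ⁻¹
    ∏±-⁻¹ h a zero    = refl
    ∏±-⁻¹ h a (suc L) = cong₂ _·_ (^-⁻¹ (σ a) (h a)) (∏±-⁻¹ h (suc a) L)

    ∏±-cong : ∀ {h g} a L → (∀ n → a ≤ n → h n ≈ g n) → ∏± h a L ≈ ∏± g a L
    ∏±-cong a zero    h≈g = ≈-refl
    ∏±-cong a (suc L) h≈g =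
      ·-cong (^-cong (σ a) (h≈g a ≤-refl)) (∏±-cong (suc a) L (λ n a<n → h≈g n (<⇒≤ a<n)))

    ∏±-++ : ∀ h a L K → ∏± h a (L + K) ≡ ∏± h a L · ∏± h (a + L) K
    ∏±-++ h a zero    K = sym (trans (·-identityˡ _) (cong (λ b → ∏± h b K) (+-identityʳ a)))
    ∏±-++ h a (suc L) K = begin
        h a ^[ σ a ] · ∏± h (suc a) (L + K)
          ≡⟨ cong (h a ^[ σ a ] ·_) (∏±-++ h (suc a) L K) ⟩
        h a ^[ σ a ] · (∏± h (suc a) L · ∏± h (suc a + L) K)
          ≡⟨ sym (·-assoc (h a ^[ σ a ]) (∏± h (suc a) L) (∏± h (suc a + L) K)) ⟩
        ∏± h a (suc L) · ∏± h (suc a + L) K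
          ≡⟨ cong (λ b → ∏± h a (suc L) · ∏± h b K) (sym (+-suc a L)) ⟩
        ∏± h a (suc L) · ∏± h (a + suc L) K ∎
      where open ≡-Reasoning

    ∏±-snoc : ∀ h a L → ∏± h a (suc L) ≡ ∏± h a L · h (a + L) ^[ σ (a + L) ]
    ∏±-snoc h a L = begin
        ∏± h a (suc L)                                   ≡⟨ cong (∏± h a) (+-comm 1 L) ⟩
        ∏± h a (L + 1)                                   ≡⟨ ∏±-++ h a L 1 ⟩
        ∏± h a L · (h (a + L) ^[ σ (a + L) ] · 1F)       ≡⟨ cong (∏± h a L ·_) (·-identityʳ (h (a + L) ^[ σ (a + L) ])) ⟩
        ∏± h a L · h (a + L) ^[ σ (a + L) ]              ∎
      where open ≡-Reasoning

    ∏±≼∏ : ∀ {h} a L → (∀ n → 1F ≼ h n) → ∏± h a L ≼ ∏ h a L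
    ∏±≼∏ a zero    1≼h = ≼-refl
    ∏±≼∏ a (suc L) 1≼h = ·-mono-≼ (^-≼ (σ a) (1≼h a)) (∏±≼∏ (suc a) L 1≼h)

    ∏⁻¹≼∏± : ∀ {h} a L → (∀ n → 1F ≼ h n) → (∏ h a L) ⁻¹ ≼ ∏± h a L
    ∏⁻¹≼∏± a zero    1≼h = ≼-refl
    ∏⁻¹≼∏± a (suc L) 1≼h = ·-mono-≼ (^-≽ (σ a) (1≼h a)) (∏⁻¹≼∏± (suc a) L 1≼h)

    module ThueMorseSign (σ-double   : ∀ n → σ (n + n) ≡ σ n)
                         (σ-double+1 : ∀ n → σ (suc (n + n)) ≡ not (σ n)) where

      ∏±-pairs : ∀ h m L → ∏± h (m + m) (L + L) ≡ ∏± (pairRatio h) m L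
      ∏±-pairs h m zero    = refl
      ∏±-pairs h m (suc L) = begin
          ∏± h (m + m) (suc L + suc L)
            ≡⟨ cong (λ k → ∏± h (m + m) (suc k)) (+-suc L L) ⟩
          h (m + m) ^[ σ (m + m) ] · (h (suc (m + m)) ^[ σ (suc (m + m)) ] · ∏± h (suc (suc (m + m))) (L + L))
            ≡⟨ cong₂ (λ s t → h (m + m) ^[ s ] · (h (suc (m + m)) ^[ t ] · ∏± h (suc (suc (m + m))) (L + L)))
                     (σ-double m) (σ-double+1 m) ⟩
          h (m + m) ^[ σ m ] · (h (suc (m + m)) ^[ not (σ m) ] · ∏± h (suc (suc (m + m))) (L + L))
            ≡⟨ cong₂ (λ y k → h (m + m) ^[ σ m ] · (y · ∏± h k (L + L)))
                     (^-not (σ m) (h (suc (m + m)))) (sym (+-suc (suc m) m)) ⟩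
          h (m + m) ^[ σ m ] · ((h (suc (m + m)) ⁻¹) ^[ σ m ] · ∏± h (suc m + suc m) (L + L))
            ≡⟨ sym (·-assoc (h (m + m) ^[ σ m ]) ((h (suc (m + m)) ⁻¹) ^[ σ m ]) (∏± h (suc m + suc m) (L + L))) ⟩
          h (m + m) ^[ σ m ] · (h (suc (m + m)) ⁻¹) ^[ σ m ] · ∏± h (suc m + suc m) (L + L)
            ≡⟨ cong₂ _·_ (sym (^-distrib-· (σ m) (h (m + m)) _)) (∏±-pairs h (suc m) L) ⟩
          ∏± (pairRatio h) m (suc L) ∎
        where open ≡-Reasoning

      module _ {h : ℕ → Frac} (1≼h : ∀ n → 1F ≼ h n) (h-antitone : ∀ n → h (suc n) ≼ h n) where
        open import Relation.Binary.Reasoning.Preorder ≼-preorder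

        1≼pairRatio : ∀ n → 1F ≼ pairRatio h n
        1≼pairRatio n = begin
            1F                                      ≈⟨ ·-inverseʳ (h (suc (n + n))) ⟨
            h (suc (n + n)) · h (suc (n + n)) ⁻¹    ≲⟨ ·-mono-≼ (h-antitone (n + n)) (≼-refl {h (suc (n + n)) ⁻¹}) ⟩
            pairRatio h n                           ∎

        -- The pair ratios telescope: ∏_{m ≤ n < m+L} h(2n)/h(2n+1) · h(2(m+L)) ≤ h(2m),
        -- since h(2n+2) ≤ h(2n+1).
        telescope : ∀ m L → ∏ (pairRatio h) m L · h ((m + L) + (m + L)) ≼ h (m + m)
        telescope m zero    = ≈⇒≼ (≡⇒≈ (trans (·-identityˡ _) (cong (λ k → h (k + k)) (+-identityʳ m))))
        telescope m (suc L) = begin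
            ∏ (pairRatio h) m (suc L) · h ((m + suc L) + (m + suc L))
              ≡⟨ cong (λ k → ∏ (pairRatio h) m (suc L) · h (k + k)) (+-suc m L) ⟩
            pairRatio h m · ∏ (pairRatio h) (suc m) L · h ((suc m + L) + (suc m + L))
              ≡⟨ ·-assoc (pairRatio h m) (∏ (pairRatio h) (suc m) L) (h ((suc m + L) + (suc m + L))) ⟩
            pairRatio h m · (∏ (pairRatio h) (suc m) L · h ((suc m + L) + (suc m + L)))
              ≲⟨ ·-mono-≼ (≼-refl {pairRatio h m}) (telescope (suc m) L) ⟩
            pairRatio h m · h (suc m + suc m)
              ≡⟨ cong (λ k → pairRatio h m · h k) (+-suc (suc m) m) ⟩
            pairRatio h m · h (suc (suc (m + m)))
              ≲⟨ ·-mono-≼ (≼-refl {pairRatio h m}) (h-antitone (suc (m + m))) ⟩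
            h (m + m) · h (suc (m + m)) ⁻¹ · h (suc (m + m))
              ≈⟨ ·-⁻¹-cancelʳ (h (m + m)) (h (suc (m + m))) ⟩
            h (m + m) ∎

        ∏pairRatio≼ : ∀ m L → ∏ (pairRatio h) m L ≼ h (m + m)
        ∏pairRatio≼ m L = ≼-trans (≼-·-grow (1≼h _)) (telescope m L)

        even-block-≼ : ∀ m L → ∏± h (m + m) (L + L) ≼ h (m + m)
        even-block-≼ m L = subst (_≼ h (m + m)) (sym (∏±-pairs h m L))
                             (≼-trans (∏±≼∏ m L 1≼pairRatio) (∏pairRatio≼ m L))

        even-block-≽ : ∀ m L → h (m + m) ⁻¹ ≼ ∏± h (m + m) (L + L)
        even-block-≽ m L = subst (h (m + m) ⁻¹ ≼_) (sym (∏±-pairs h m L))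
                             (≼-trans (⁻¹-antitone (∏pairRatio≼ m L)) (∏⁻¹≼∏± m L 1≼pairRatio))

        -- The block [N, 2N): h(N)^{-2} ≤ ∏_{N ≤ n < 2N} h(n)^{σ(n)} ≤ h(N)^2.  For odd N the first
        -- factor is split off and the rest starts at the even index N+1.
        block-bound : ∀ N → (h N · h N) ⁻¹ ≼ ∏± h N N × ∏± h N N ≼ h N · h N
        block-bound N with even-or-odd N
        ... | inj₁ (m , refl) = ≼-trans (⁻¹-antitone (≼-·-grow (1≼h N))) (even-block-≽ m m)
                              , ≼-trans (even-block-≼ m m) (≼-·-grow (1≼h N))
        ... | inj₂ (m , refl) = ·-mono-≼ (^-≽ (σ N) (1≼h N)) rest-≽ , ·-mono-≼ (^-≼ (σ N) (1≼h N)) rest-≼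
          where
          next-even : suc m + suc m ≡ suc N
          next-even = +-suc (suc m) m
          rest-≼ : ∏± h (suc N) (m + m) ≼ h N
          rest-≼ = subst (λ k → ∏± h k (m + m) ≼ h N) next-even
                     (≼-trans (even-block-≼ (suc m) m) (subst (λ k → h k ≼ h N) (sym next-even) (h-antitone N)))
          rest-≽ : h N ⁻¹ ≼ ∏± h (suc N) (m + m)
          rest-≽ = subst (λ k → h N ⁻¹ ≼ ∏± h k (m + m)) next-even
                     (≼-trans (subst (λ k → h N ⁻¹ ≼ h k ⁻¹) (sym next-even) (⁻¹-antitone (h-antitone N)))
                              (even-block-≽ (suc m) m))

module ProductIdentity where
  open import Data.Nat using (ℕ; zero; suc; _+_; _*_; _≤_; NonZero)
  open import Data.Nat.Tactic.RingSolver using (solve-∀)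
  open import Relation.Binary.PropositionalEquality
  open import Defs using (uIsPlusOne)
  open Fraction
  open SignedProducts
  open WithSign uIsPlusOne
  open ThueMorseSign ThueMorse.sign-double ThueMorse.sign-double+1
  import Algebra.Solver.CommutativeMonoid ·-commutativeMonoid as CM
  open CM using (_⊕_; _⊜_)

  r : (m : ℕ) → .{{NonZero m}} → Frac
  r m = m ÷ suc m

  -- n/(n+1), with the value at 0 replaced by 1/2 to keep it positive; the value at 0 cancels from
  -- the identity below, and this choice keeps ρ increasing.
  ρ : ℕ → Frac
  ρ zero    = r 1
  ρ (suc n) = r (suc n)


  f : ℕ → Frac
  f n = (3 + 4 * n) * (2 + 2 * n) ÷ ((5 + 4 * n) * (3 + 2 * n))

  b₁ b₂ : ℕ → Frac
  b₁ n = r (suc (n + n))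
  b₂ n = r (suc (suc (n + n)))

  c₂ c₃ c₄ : ℕ → Frac
  c₂ n = r (2 + 4 * n)
  c₃ n = r (3 + 4 * n)
  c₄ n = r (4 + 4 * n)

  f-factors : ∀ n → f n ≈ c₃ n · c₄ n · b₂ n
  f-factors n = mk≈ (eq n)
    where
    eq : ∀ n → (3 + 4 * n) * (2 + 2 * n) * (suc (3 + 4 * n) * suc (4 + 4 * n) * suc (suc (suc (n + n))))
             ≡ (3 + 4 * n) * (4 + 4 * n) * suc (suc (n + n)) * ((5 + 4 * n) * (3 + 2 * n))
    eq = solve-∀

  b₁-factors : ∀ n → b₁ n ≈ c₂ n · c₃ n
  b₁-factors n = mk≈ (eq n)
    where
    eq : ∀ n → suc (n + n) * (suc (2 + 4 * n) * suc (3 + 4 * n)) ≡ (2 + 4 * n) * (3 + 4 * n) * suc (suc (n + n))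
    eq = solve-∀

  b₂-pairRatio : ∀ n → pairRatio b₂ n ≈ c₂ n · c₄ n ⁻¹
  b₂-pairRatio n = mk≈ (eq n)
    where
    eq : ∀ n → suc (suc ((n + n) + (n + n))) * suc (suc (suc (suc (n + n) + suc (n + n)))) * (suc (2 + 4 * n) * (4 + 4 * n))
             ≡ (2 + 4 * n) * suc (4 + 4 * n) * (suc (suc (suc ((n + n) + (n + n)))) * suc (suc (suc (n + n) + suc (n + n))))
    eq = solve-∀

  b₁ρ-halves : ∀ n → b₁ (suc n) · ρ (suc n + suc n) ≈ ρ (suc n)
  b₁ρ-halves n = mk≈ (eq n)
    where
    eq : ∀ n → suc (suc n + suc n) * (suc n + suc n) * suc (suc n)
             ≡ suc n * (suc (suc (suc n + suc n)) * suc (suc n + suc n))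
    eq = solve-∀

  -- d(n) = (n+1)(2n+3)² / (n(2n+2)²), the factor of the block product (with d(0) adjusted via ρ).
  d : ℕ → Frac
  d n = (ρ n · b₂ n · b₂ n) ⁻¹

  2F half : Frac
  2F   = 2 ÷ 1
  half = 1 ÷ 2

  P : ℕ → Frac
  P M = ∏± f 0 M

  -- The key identity 2 P(N)² = ∏_{N ≤ n < 2N} d(n)^{u_n} for N = N' + 1.  Writing products
  -- over [0, N) and [N, 2N) of a factor g as ∏± g 0 N and ∏± g N N, it follows from
  --   P = C₃ C₄ B,  B B' = C₂ / C₄,  O = C₂ C₃,  A A' = E / O,  O E = A / 2
  -- which come from the factorisations above and from folding ranges [0, 2N) into pairs.
  module KeyIdentity (N' : ℕ) where
    N : ℕ
    N = suc N'

    A A′ B B′ O E C₂ C₃ C₄ : Frac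
    A  = ∏± ρ 0 N
    A′ = ∏± ρ N N
    B  = ∏± b₂ 0 N
    B′ = ∏± b₂ N N
    O  = ∏± b₁ 0 N
    E  = ∏± (λ n → ρ (n + n)) 0 N
    C₂ = ∏± c₂ 0 N
    C₃ = ∏± c₃ 0 N
    C₄ = ∏± c₄ 0 N

    P-factors : P N ≈ C₃ · C₄ · B
    P-factors = ≈-trans (∏±-cong 0 N (λ n _ → f-factors n))
                        (≡⇒≈ (trans (∏±-· (λ n → c₃ n · c₄ n) b₂ 0 N) (cong (_· B) (∏±-· c₃ c₄ 0 N))))

    O-factors : O ≈ C₂ · C₃
    O-factors = ≈-trans (∏±-cong 0 N (λ n _ → b₁-factors n)) (≡⇒≈ (∏±-· c₂ c₃ 0 N))

    AA′-pairs : A · A′ ≡ E · O ⁻¹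
    AA′-pairs = begin
        A · A′            ≡⟨ sym (∏±-++ ρ 0 N N) ⟩
        ∏± ρ 0 (N + N)    ≡⟨ ∏±-pairs ρ 0 N ⟩
        ∏± (pairRatio ρ) 0 N
                          ≡⟨ trans (∏±-· (λ n → ρ (n + n)) (λ n → b₁ n ⁻¹) 0 N) (cong (E ·_) (∏±-⁻¹ b₁ 0 N)) ⟩
        E · O ⁻¹          ∎
      where open ≡-Reasoning

    open import Relation.Binary.Reasoning.Setoid ≈-setoid

    BB′-pairs : B · B′ ≈ C₂ · C₄ ⁻¹
    BB′-pairs = begin
        B · B′                         ≡⟨ sym (∏±-++ b₂ 0 N N) ⟩
        ∏± b₂ 0 (N + N)                ≡⟨ ∏±-pairs b₂ 0 N ⟩
        ∏± (pairRatio b₂) 0 N          ≈⟨ ∏±-cong 0 N (λ n _ → b₂-pairRatio n) ⟩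
        ∏± (λ n → c₂ n · c₄ n ⁻¹) 0 N  ≡⟨ trans (∏±-· c₂ (λ n → c₄ n ⁻¹) 0 N) (cong (C₂ ·_) (∏±-⁻¹ c₄ 0 N)) ⟩
        C₂ · C₄ ⁻¹                     ∎

    -- The first factor is b₁(0) ρ(0) = 1/2 · ρ(0) (its sign is u₀ = +1); the others are ρ(n).
    OE-halves : O · E ≈ half · A
    OE-halves = begin
        O · E                                        ≡⟨ sym (∏±-· b₁ (λ n → ρ (n + n)) 0 N) ⟩
        half · ρ 0 · ∏± (λ n → b₁ n · ρ (n + n)) 1 N' ≈⟨ ·-cong (≈-refl {half · ρ 0}) (∏±-cong 1 N' later) ⟩
        half · ρ 0 · ∏± ρ 1 N'                        ≡⟨ ·-assoc half (ρ 0) (∏± ρ 1 N') ⟩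
        half · A                                     ∎
      where
      later : ∀ n → 1 ≤ n → b₁ n · ρ (n + n) ≈ ρ n
      later (suc n) _ = b₁ρ-halves n

    PB′≈O : P N · B′ ≈ O
    PB′≈O = begin
        P N · B′                    ≈⟨ ·-cong P-factors (≈-refl {B′}) ⟩
        C₃ · C₄ · B · B′            ≡⟨ ·-assoc (C₃ · C₄) B B′ ⟩
        C₃ · C₄ · (B · B′)          ≈⟨ ·-cong (≈-refl {C₃ · C₄}) BB′-pairs ⟩
        C₃ · C₄ · (C₂ · C₄ ⁻¹)      ≡⟨ CM.solve 4 (λ c₂ c₃ c₄ c₄⁻¹ → (c₃ ⊕ c₄) ⊕ (c₂ ⊕ c₄⁻¹) ⊜ ((c₂ ⊕ c₃) ⊕ c₄⁻¹) ⊕ c₄)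
                                             refl C₂ C₃ C₄ (C₄ ⁻¹) ⟩
        C₂ · C₃ · C₄ ⁻¹ · C₄        ≈⟨ ·-⁻¹-cancelʳ (C₂ · C₃) C₄ ⟩
        C₂ · C₃                     ≈⟨ O-factors ⟨
        O                           ∎

    OOA′≈half : O · O · A′ ≈ half
    OOA′≈half = ·-cancelˡ A (begin
        A · (O · O · A′)            ≡⟨ CM.solve 3 (λ a a′ o → a ⊕ ((o ⊕ o) ⊕ a′) ⊜ o ⊕ (o ⊕ (a ⊕ a′))) refl A A′ O ⟩
        O · (O · (A · A′))          ≡⟨ cong (λ x → O · (O · x)) AA′-pairs ⟩
        O · (O · (E · O ⁻¹))        ≡⟨ CM.solve 3 (λ o e o⁻¹ → o ⊕ (o ⊕ (e ⊕ o⁻¹)) ⊜ ((o ⊕ e) ⊕ o⁻¹) ⊕ o) refl O E (O ⁻¹) ⟩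
        O · E · O ⁻¹ · O            ≈⟨ ·-⁻¹-cancelʳ (O · E) O ⟩
        O · E                       ≈⟨ OE-halves ⟩
        half · A                    ≡⟨ ·-comm half A ⟩
        A · half                    ∎)

    2PP·A′B′B′≈1 : 2F · (P N · P N) · (A′ · B′ · B′) ≈ 1F
    2PP·A′B′B′≈1 = begin
        2F · (P N · P N) · (A′ · B′ · B′) ≡⟨ CM.solve 4 (λ t p a′ b′ → (t ⊕ (p ⊕ p)) ⊕ ((a′ ⊕ b′) ⊕ b′)
                                                              ⊜ t ⊕ (((p ⊕ b′) ⊕ (p ⊕ b′)) ⊕ a′))
                                                 refl 2F (P N) A′ B′ ⟩
        2F · ((P N · B′) · (P N · B′) · A′) ≈⟨ ·-cong (≈-refl {2F}) (·-cong (·-cong PB′≈O PB′≈O) (≈-refl {A′})) ⟩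
        2F · (O · O · A′)               ≈⟨ ·-cong (≈-refl {2F}) OOA′≈half ⟩
        2F · half                       ≈⟨ ·-inverseʳ 2F ⟩
        1F                              ∎

    key-identity : 2F · (P N · P N) ≈ ∏± d N N
    key-identity = begin
        2F · (P N · P N)       ≈⟨ ·≈1⇒≈⁻¹ {2F · (P N · P N)} {A′ · B′ · B′} 2PP·A′B′B′≈1 ⟩
        (A′ · B′ · B′) ⁻¹      ≡⟨ cong _⁻¹ (sym (trans (∏±-· (λ n → ρ n · b₂ n) b₂ N N) (cong (_· B′) (∏±-· ρ b₂ N N)))) ⟩
        (∏± (λ n → ρ n · b₂ n · b₂ n) N N) ⁻¹ ≡⟨ sym (∏±-⁻¹ (λ n → ρ n · b₂ n · b₂ n) N N) ⟩
        ∏± d N N               ∎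

module Estimates where
  open import Data.Nat using (ℕ; zero; suc; _+_; _*_; _≤_; NonZero; s≤s)
  open import Data.Nat.Properties using (≤-reflexive; +-mono-≤; *-comm; n≤1+n; *-suc)
  open import Data.Nat.Tactic.RingSolver using (solve-∀)
  open import Data.Product using (_×_; _,_; proj₁; proj₂)
  open import Relation.Binary.PropositionalEquality
  open import Defs using (uIsPlusOne)
  open Fraction
  open SignedProducts
  open WithSign uIsPlusOne
  open ThueMorseSign ThueMorse.sign-double ThueMorse.sign-double+1
  open ProductIdentity
  open import Relation.Binary.Reasoning.Preorder ≼-preorder

  r-mono : ∀ {m m′} .{{_ : NonZero m}} .{{_ : NonZero m′}} → m ≤ m′ → r m ≼ r m′
  r-mono {m} {m′} m≤m′ = mk≼ (subst₂ _≤_ (sym (*-suc m m′)) (sym (*-suc m′ m))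
                                      (+-mono-≤ m≤m′ (≤-reflexive (*-comm m m′))))

  r≼1 : ∀ m .{{_ : NonZero m}} → r m ≼ 1F
  r≼1 m = ÷-≼ 1 (eq m)
    where
    eq : ∀ m → m * 1 + 1 ≡ 1 * suc m
    eq = solve-∀

  ρ≼1 : ∀ n → ρ n ≼ 1F
  ρ≼1 zero    = r≼1 1
  ρ≼1 (suc n) = r≼1 (suc n)

  ρ-mono : ∀ n → ρ n ≼ ρ (suc n)
  ρ-mono zero    = ≼-refl
  ρ-mono (suc n) = r-mono (n≤1+n (suc n))

  b₂-mono : ∀ n → b₂ n ≼ b₂ (suc n)
  b₂-mono n = r-mono (s≤s (s≤s (+-mono-≤ (n≤1+n n) (n≤1+n n))))

  1≼d : ∀ n → 1F ≼ d n
  1≼d n = ⁻¹-antitone (·-mono-≼ (·-mono-≼ (ρ≼1 n) (r≼1 _)) (r≼1 _))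

  d-antitone : ∀ n → d (suc n) ≼ d n
  d-antitone n = ⁻¹-antitone (·-mono-≼ (·-mono-≼ (ρ-mono n) (b₂-mono n)) (b₂-mono n))

  -- (N+4)/N, written for N = n+1.
  ratio₄ : ℕ → Frac
  ratio₄ n = (5 + n) ÷ suc n

  d-bound : ∀ n → d (suc n) ≼ ratio₄ n
  d-bound n = ÷-≼ (suc n * (8 * n * n + 31 * n + 30)) (eq n)
    where
    eq : ∀ n → suc (suc n) * suc (suc (suc (suc n + suc n))) * suc (suc (suc (suc n + suc n))) * suc n
               + suc n * (8 * n * n + 31 * n + 30)
             ≡ (5 + n) * (suc n * suc (suc (suc n + suc n)) * suc (suc (suc n + suc n)))
    eq = solve-∀

  square-bound : ∀ Q t .{{_ : NonZero Q}} →
                 ratio₄ (8 * Q + 1 + t) · ratio₄ (8 * Q + 1 + t) ≼ suc Q ÷ Q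
  square-bound Q t = ÷-≼ (8 * Q * t + (2 + t) * (2 + t)) (eq Q t)
    where
    eq : ∀ Q t → (5 + (8 * Q + 1 + t)) * (5 + (8 * Q + 1 + t)) * Q + (8 * Q * t + (2 + t) * (2 + t))
               ≡ suc Q * (suc (8 * Q + 1 + t) * suc (8 * Q + 1 + t))
    eq = solve-∀

  below-reciprocal : ∀ k .{{_ : NonZero k}} → k ÷ suc k ≼ (suc (suc k) ÷ suc k) ⁻¹
  below-reciprocal k = ÷-≼ 1 (eq k)
    where
    eq : ∀ k → k * suc (suc k) + 1 ≡ suc k * suc k
    eq = solve-∀

  two-P²-bounds : ∀ k t .{{_ : NonZero k}} → let N = suc (8 * suc k + 1 + t) in
                  k ÷ suc k ≼ 2F · (P N · P N) × 2F · (P N · P N) ≼ suc (suc k) ÷ suc k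
  two-P²-bounds k t = lower , upper
    where
    n : ℕ
    n = 8 * suc k + 1 + t
    open KeyIdentity n using (key-identity)
    dd≼ : d (suc n) · d (suc n) ≼ suc (suc k) ÷ suc k
    dd≼ = ≼-trans (·-mono-≼ (d-bound n) (d-bound n)) (square-bound (suc k) t)
    block : (d (suc n) · d (suc n)) ⁻¹ ≼ ∏± d (suc n) (suc n) × ∏± d (suc n) (suc n) ≼ d (suc n) · d (suc n)
    block = block-bound 1≼d d-antitone (suc n)
    upper : 2F · (P (suc n) · P (suc n)) ≼ suc (suc k) ÷ suc k
    upper = begin
      2F · (P (suc n) · P (suc n))    ≈⟨ key-identity ⟩
      ∏± d (suc n) (suc n)            ≲⟨ proj₂ block ⟩
      d (suc n) · d (suc n)           ≲⟨ dd≼ ⟩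
      suc (suc k) ÷ suc k             ∎
    lower : k ÷ suc k ≼ 2F · (P (suc n) · P (suc n))
    lower = begin
      k ÷ suc k                       ≲⟨ below-reciprocal k ⟩
      (suc (suc k) ÷ suc k) ⁻¹        ≲⟨ ⁻¹-antitone dd≼ ⟩
      (d (suc n) · d (suc n)) ⁻¹      ≲⟨ proj₁ block ⟩
      ∏± d (suc n) (suc n)            ≈⟨ key-identity ⟨
      2F · (P (suc n) · P (suc n))    ∎

module Interpretation where
  open import Data.Nat as ℕ using (zero; suc; s≤s; z≤n)
  open import Data.Integer as ℤ using (+_)
  import Data.Integer.Properties as ℤ
  open import Data.Rational as ℚ using (ℚ; toℚᵘ)
  import Data.Rational.Properties as ℚ
  open import Data.Rational.Unnormalised as ℚᵘ using (ℚᵘ; *≡*; *≤*; *<*; _≃_)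
  import Data.Rational.Unnormalised.Properties as ℚᵘ
  open import Data.Bool using (true; false)
  open import Relation.Binary.PropositionalEquality
  open import Defs using (uIsPlusOne; term; partialProduct; two)
  open Fraction
  open SignedProducts
  open WithSign uIsPlusOne
  open ProductIdentity

  ⟦_⟧ : Frac → ℚᵘ
  ⟦ a ÷ b ⟧ = + a ℚᵘ./ b

  ⟦·⟧ : ∀ x y → ⟦ x ⟧ ℚᵘ.* ⟦ y ⟧ ≃ ⟦ x · y ⟧
  ⟦·⟧ (_÷_ a zero {{_}} {{()}}) y
  ⟦·⟧ (a ÷ suc b) (_÷_ c zero {{_}} {{()}})
  ⟦·⟧ (a ÷ suc b) (c ÷ suc d) = *≡* (cong (ℤ._* (+ (suc b ℕ.* suc d))) (sym (ℤ.pos-* a c)))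

  ⟦≼⟧ : ∀ {x y} → x ≼ y → ⟦ x ⟧ ℚᵘ.≤ ⟦ y ⟧
  ⟦≼⟧ {_÷_ a zero {{_}} {{()}}}
  ⟦≼⟧ {a ÷ suc b} {_÷_ c zero {{_}} {{()}}}
  ⟦≼⟧ {a ÷ suc b} {c ÷ suc d} (mk≼ p) = *≤* (subst₂ ℤ._≤_ (ℤ.pos-* a (suc d)) (ℤ.pos-* c (suc b)) (ℤ.+≤+ p))

  ⟦⟧-positive : ∀ x → ℚᵘ.0ℚᵘ ℚᵘ.< ⟦ x ⟧
  ⟦⟧-positive (_÷_ zero b {{()}})
  ⟦⟧-positive (_÷_ (suc a) zero {{_}} {{()}})
  ⟦⟧-positive (suc a ÷ suc b) = *<* (ℤ.+<+ (s≤s z≤n))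

  ⟦term⟧ : ∀ n → toℚᵘ (term n) ≃ ⟦ f n ^[ uIsPlusOne n ] ⟧
  ⟦term⟧ n with uIsPlusOne n
  ... | true  = ℚ.toℚᵘ-fromℚᵘ ⟦ f n ⟧
  ... | false = ℚ.toℚᵘ-fromℚᵘ ⟦ f n ⁻¹ ⟧

  ⟦partialProduct⟧ : ∀ M → toℚᵘ (partialProduct M) ≃ ⟦ P M ⟧
  ⟦partialProduct⟧ zero    = ℚᵘ.≃-refl
  ⟦partialProduct⟧ (suc M) = begin
      toℚᵘ (partialProduct M ℚ.* term M)                ≈⟨ ℚ.toℚᵘ-homo-* (partialProduct M) (term M) ⟩
      toℚᵘ (partialProduct M) ℚᵘ.* toℚᵘ (term M)        ≈⟨ ℚᵘ.*-cong (⟦partialProduct⟧ M) (⟦term⟧ M) ⟩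
      ⟦ P M ⟧ ℚᵘ.* ⟦ f M ^[ uIsPlusOne M ] ⟧            ≈⟨ ⟦·⟧ (P M) (f M ^[ uIsPlusOne M ]) ⟩
      ⟦ P M · f M ^[ uIsPlusOne M ] ⟧                   ≡⟨ cong ⟦_⟧ (sym (∏±-snoc f 0 M)) ⟩
      ⟦ P (suc M) ⟧                                     ∎
    where open ℚᵘ.≃-Reasoning

  ⟦two-P²⟧ : ∀ M → toℚᵘ (two ℚ.* (partialProduct M ℚ.* partialProduct M)) ≃ ⟦ 2F · (P M · P M) ⟧
  ⟦two-P²⟧ M = begin
      toℚᵘ (two ℚ.* (x ℚ.* x))                   ≈⟨ ℚ.toℚᵘ-homo-* two (x ℚ.* x) ⟩
      toℚᵘ two ℚᵘ.* toℚᵘ (x ℚ.* x)               ≈⟨ ℚᵘ.*-cong (ℚ.toℚᵘ-fromℚᵘ ⟦ 2F ⟧) (ℚ.toℚᵘ-homo-* x x) ⟩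
      ⟦ 2F ⟧ ℚᵘ.* (toℚᵘ x ℚᵘ.* toℚᵘ x)           ≈⟨ ℚᵘ.*-cong (ℚᵘ.≃-refl {⟦ 2F ⟧}) (ℚᵘ.*-cong (⟦partialProduct⟧ M) (⟦partialProduct⟧ M)) ⟩
      ⟦ 2F ⟧ ℚᵘ.* (⟦ P M ⟧ ℚᵘ.* ⟦ P M ⟧)          ≈⟨ ℚᵘ.*-cong (ℚᵘ.≃-refl {⟦ 2F ⟧}) (⟦·⟧ (P M) (P M)) ⟩
      ⟦ 2F ⟧ ℚᵘ.* ⟦ P M · P M ⟧                  ≈⟨ ⟦·⟧ 2F (P M · P M) ⟩
      ⟦ 2F · (P M · P M) ⟧                       ∎
    where
    open ℚᵘ.≃-Reasoning
    x : ℚ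
    x = partialProduct M

module Squeeze where
  open import Data.Rational
  open import Data.Rational.Properties
  open import Data.Rational.Solver using (module +-*-Solver)
  open import Data.Product using (_×_; _,_)
  open import Data.Sum using (inj₁; inj₂)
  open import Relation.Nullary using (yes; no)
  open import Relation.Binary.PropositionalEquality
  open import Defs using (two; BelowInvSqrt2; AboveInvSqrt2)
  open +-*-Solver

  0≤-difference : ∀ {p q} → p ≤ q → 0ℚ ≤ q - p
  0≤-difference {p} {q} p≤q = subst (_≤ q - p) (+-inverseʳ p) (+-monoˡ-≤ (- p) p≤q)

  0<-difference : ∀ {p q} → p < q → 0ℚ < q - p
  0<-difference {p} {q} p<q = subst (_< q - p) (+-inverseʳ p) (+-monoˡ-< (- p) p<q)

  0<-* : ∀ {p q} → 0ℚ < p → 0ℚ < q → 0ℚ < p * q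
  0<-* {p} {q} 0<p 0<q = positive⁻¹ (p * q) {{pos*pos⇒pos p {{positive 0<p}} q {{positive 0<q}}}}

  0<-+ : ∀ {p q} → 0ℚ ≤ p → 0ℚ < q → 0ℚ < p + q
  0<-+ {p} {q} 0≤p 0<q = subst (_< p + q) (+-identityʳ 0ℚ) (+-mono-≤-< 0≤p 0<q)

  -- The two estimates are the
  -- identities 2(x+ε)² = (2x²+δ) + (ε²−δ) + (ε² + 4xε) and, when x > ε,
  -- 2(x−ε)² + (1+δ−2x²) + (ε²−δ) + (4(x−ε)ε + ε²) = 1.
  squeeze : ∀ x ε δ → 0ℚ < x → 0ℚ < ε → δ ≤ ε * ε →
            two * (x * x) ≤ 1ℚ + δ → 1ℚ ≤ two * (x * x) + δ →
            BelowInvSqrt2 (x - ε) × AboveInvSqrt2 (x + ε)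
  squeeze x ε δ 0<x 0<ε δ≤ε² upper lower = below , (0<-+ (<⇒≤ 0<x) 0<ε , above)
    where
    four : ℚ
    four = two * two
    0<four : 0ℚ < four
    0<four = 0<-* (positive⁻¹ two) (positive⁻¹ two)

    expand-plus : two * ((x + ε) * (x + ε))
                ≡ (two * (x * x) + δ) + ((ε * ε - δ) + (ε * ε + four * (x * ε)))
    expand-plus = solve 3 (λ x ε δ → con two :* ((x :+ ε) :* (x :+ ε))
                                    := (con two :* (x :* x) :+ δ) :+ ((ε :* ε :- δ) :+ (ε :* ε :+ (con two :* con two) :* (x :* ε))))
                          refl x ε δ

    expand-minus : two * ((x - ε) * (x - ε)) + ((1ℚ + δ - two * (x * x)) + ((ε * ε - δ) + (four * ((x - ε) * ε) + ε * ε)))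
                 ≡ 1ℚ
    expand-minus = solve 3 (λ x ε δ → (con two :* ((x :- ε) :* (x :- ε)))
                                       :+ ((con 1ℚ :+ δ :- con two :* (x :* x)) :+ ((ε :* ε :- δ) :+ ((con two :* con two) :* ((x :- ε) :* ε) :+ ε :* ε)))
                                     := con 1ℚ)
                           refl x ε δ

    above : 1ℚ < two * ((x + ε) * (x + ε))
    above = subst (1ℚ <_) (sym expand-plus)
      (subst (_< (two * (x * x) + δ) + ((ε * ε - δ) + (ε * ε + four * (x * ε)))) (+-identityʳ 1ℚ)
        (+-mono-≤-< lower (0<-+ (0≤-difference δ≤ε²) (0<-+ (<⇒≤ (0<-* 0<ε 0<ε)) (0<-* 0<four (0<-* 0<x 0<ε))))))

    below : BelowInvSqrt2 (x - ε)
    below with x ≤? ε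
    ... | yes x≤ε = inj₁ (subst (x - ε ≤_) (+-inverseʳ ε) (+-monoˡ-≤ (- ε) x≤ε))
    ... | no  x≰ε = inj₂ (subst₂ _<_ (+-identityʳ _) expand-minus (+-monoʳ-< (two * ((x - ε) * (x - ε))) slack))
      where
      slack : 0ℚ < (1ℚ + δ - two * (x * x)) + ((ε * ε - δ) + (four * ((x - ε) * ε) + ε * ε))
      slack = 0<-+ (0≤-difference upper) (0<-+ (0≤-difference δ≤ε²)
                (0<-+ (<⇒≤ (0<-* 0<four (0<-* (0<-difference (≰⇒> x≰ε)) 0<ε))) (0<-* 0<ε 0<ε)))

module Convergence where
  open import Data.Nat as ℕ using (ℕ; zero; suc)
  import Data.Nat.Properties as ℕ
  open import Data.Nat.Tactic.RingSolver using (solve-∀)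
  open import Data.Integer as ℤ using (+_)
  import Data.Integer.Properties as ℤ
  open import Data.Rational as ℚ using (ℚ; mkℚ; 0ℚ; 1ℚ; toℚᵘ)
  import Data.Rational.Properties as ℚ
  open import Data.Rational.Unnormalised as ℚᵘ using (mkℚᵘ; *≡*; *≤*; _≃_)
  import Data.Rational.Unnormalised.Properties as ℚᵘ
  open import Data.Product using (∃; _×_; _,_; proj₁; proj₂)
  open import Relation.Binary.PropositionalEquality
  open import Defs using (partialProduct; two)
  open Fraction
  open ProductIdentity using (P; 2F)
  open Estimates using (two-P²-bounds)
  open Interpretation

  tolerance : ℕ → ℚ
  tolerance j = + 1 ℚ./ suc (suc j)

  upper-split : ∀ j → ⟦ suc (suc (suc j)) ÷ suc (suc j) ⟧ ≃ ℚᵘ.1ℚᵘ ℚᵘ.+ ⟦ 1 ÷ suc (suc j) ⟧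
  upper-split j = *≡* (cong +_ (eq j))
    where
    eq : ∀ j → let Q = suc (suc j) in suc Q ℕ.* (1 ℕ.* Q) ≡ (1 ℕ.* Q ℕ.+ 1 ℕ.* 1) ℕ.* Q
    eq = solve-∀

  lower-split : ∀ j → ⟦ suc j ÷ suc (suc j) ⟧ ℚᵘ.+ ⟦ 1 ÷ suc (suc j) ⟧ ≃ ℚᵘ.1ℚᵘ
  lower-split j = *≡* (cong +_ (eq j))
    where
    eq : ∀ j → let Q = suc (suc j) in (suc j ℕ.* Q ℕ.+ 1 ℕ.* Q) ℕ.* 1 ≡ 1 ℕ.* (Q ℕ.* Q)
    eq = solve-∀

  ⟦tolerance⟧ : ∀ j → toℚᵘ (tolerance j) ≃ ⟦ 1 ÷ suc (suc j) ⟧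
  ⟦tolerance⟧ j = ℚ.toℚᵘ-fromℚᵘ ⟦ 1 ÷ suc (suc j) ⟧

  -- Every positive rational ε has ε² ≥ 1/Q for some Q: take Q = b² + 1 for ε = a/b.
  tolerance≤square : ∀ ε → 0ℚ ℚ.< ε → ∃ λ j → tolerance j ℚ.≤ ε ℚ.* ε
  tolerance≤square (mkℚ (+ zero) b _) (ℚ.*<* (ℤ.+<+ ()))
  tolerance≤square (mkℚ ℤ.-[1+ a ] b _) (ℚ.*<* ())
  tolerance≤square ε@(mkℚ ℤ.+[1+ a ] b _) _ = j , ℚ.toℚᵘ-cancel-≤ (begin
      toℚᵘ (tolerance j)             ≃⟨ ⟦tolerance⟧ j ⟩
      mkℚᵘ (+ 1) (suc j)             ≤⟨ *≤* (ℤ.+≤+ b²<Q≤a²Q) ⟩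
      toℚᵘ ε ℚᵘ.* toℚᵘ ε             ≃⟨ ℚ.toℚᵘ-homo-* ε ε ⟨
      toℚᵘ (ε ℚ.* ε)                 ∎)
    where
    open ℚᵘ.≤-Reasoning
    j = b ℕ.+ b ℕ.* suc b
    b²<Q≤a²Q : 1 ℕ.* (suc b ℕ.* suc b) ℕ.≤ (suc a ℕ.* suc a) ℕ.* suc (suc j)
    b²<Q≤a²Q = ℕ.≤-trans (ℕ.≤-trans (ℕ.≤-reflexive (ℕ.*-identityˡ _)) (ℕ.n≤1+n _)) (ℕ.m≤n*m _ (suc a ℕ.* suc a))

  partialProduct-positive : ∀ M → 0ℚ ℚ.< partialProduct M
  partialProduct-positive M = ℚ.toℚᵘ-cancel-< (ℚᵘ.<-respʳ-≃ (ℚᵘ.≃-sym (⟦partialProduct⟧ M)) (⟦⟧-positive (P M)))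

  threshold : ℕ → ℕ
  threshold j = suc (8 ℕ.* suc (suc j) ℕ.+ 1)

  square-within : ∀ j M → threshold j ℕ.≤ M →
                  let x = partialProduct M in
                  two ℚ.* (x ℚ.* x) ℚ.≤ 1ℚ ℚ.+ tolerance j × 1ℚ ℚ.≤ two ℚ.* (x ℚ.* x) ℚ.+ tolerance j
  square-within j M N≤M with ℕ.m≤n⇒∃[o]m+o≡n N≤M
  ... | t , refl = ℚ.toℚᵘ-cancel-≤ upper , ℚ.toℚᵘ-cancel-≤ lower
    where
    open ℚᵘ.≤-Reasoning
    N : ℕ
    N = threshold j ℕ.+ t
    x : ℚ
    x = partialProduct N
    X : Frac
    X = 2F · (P N · P N)
    bounds : suc j ÷ suc (suc j) ≼ X × X ≼ suc (suc (suc j)) ÷ suc (suc j)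
    bounds = two-P²-bounds (suc j) t
    upper : toℚᵘ (two ℚ.* (x ℚ.* x)) ℚᵘ.≤ toℚᵘ (1ℚ ℚ.+ tolerance j)
    upper = begin
      toℚᵘ (two ℚ.* (x ℚ.* x))                       ≃⟨ ⟦two-P²⟧ N ⟩
      ⟦ X ⟧                                          ≤⟨ ⟦≼⟧ (proj₂ bounds) ⟩
      ⟦ suc (suc (suc j)) ÷ suc (suc j) ⟧            ≃⟨ upper-split j ⟩
      ℚᵘ.1ℚᵘ ℚᵘ.+ ⟦ 1 ÷ suc (suc j) ⟧               ≃⟨ ℚᵘ.+-cong (ℚ.toℚᵘ-fromℚᵘ ℚᵘ.1ℚᵘ) (⟦tolerance⟧ j) ⟨
      toℚᵘ 1ℚ ℚᵘ.+ toℚᵘ (tolerance j)                ≃⟨ ℚ.toℚᵘ-homo-+ 1ℚ (tolerance j) ⟨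
      toℚᵘ (1ℚ ℚ.+ tolerance j)                      ∎
    lower : toℚᵘ 1ℚ ℚᵘ.≤ toℚᵘ (two ℚ.* (x ℚ.* x) ℚ.+ tolerance j)
    lower = begin
      toℚᵘ 1ℚ                                        ≃⟨ ℚ.toℚᵘ-fromℚᵘ ℚᵘ.1ℚᵘ ⟩
      ℚᵘ.1ℚᵘ                                         ≃⟨ lower-split j ⟨
      ⟦ suc j ÷ suc (suc j) ⟧ ℚᵘ.+ ⟦ 1 ÷ suc (suc j) ⟧ ≤⟨ ℚᵘ.+-monoˡ-≤ ⟦ 1 ÷ suc (suc j) ⟧ (⟦≼⟧ (proj₁ bounds)) ⟩
      ⟦ X ⟧ ℚᵘ.+ ⟦ 1 ÷ suc (suc j) ⟧                 ≃⟨ ℚᵘ.+-cong (⟦two-P²⟧ N) (⟦tolerance⟧ j) ⟨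
      toℚᵘ (two ℚ.* (x ℚ.* x)) ℚᵘ.+ toℚᵘ (tolerance j) ≃⟨ ℚ.toℚᵘ-homo-+ (two ℚ.* (x ℚ.* x)) (tolerance j) ⟨
      toℚᵘ (two ℚ.* (x ℚ.* x) ℚ.+ tolerance j)       ∎

open import Defs using (partialProduct; BelowInvSqrt2; AboveInvSqrt2)
open import Data.Nat using (ℕ) renaming (_≤_ to _≤ℕ_)
open import Data.Rational using (ℚ; 0ℚ; _<_; _+_; _-_)
open import Data.Product using (_×_; ∃; _,_)
open Squeeze using (squeeze)
open Convergence using (tolerance; tolerance≤square; threshold; square-within; partialProduct-positive)

-- Given ε, choose the tolerance 1/Q ≤ ε²; beyond the threshold 8Q + 2 the number 2P(M)² is within
-- 1/Q of 1, which places P(M) − ε below and P(M) + ε above 1/√2.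
mainTheorem12 : (ε : ℚ) → 0ℚ < ε → ∃ λ (N : ℕ) → (M : ℕ) → N ≤ℕ M →
                  BelowInvSqrt2 (partialProduct M - ε) × AboveInvSqrt2 (partialProduct M + ε)
mainTheorem12 ε 0<ε with tolerance≤square ε 0<ε
... | j , tolerance≤ε² = threshold j , λ M N≤M →
  let (upper , lower) = square-within j M N≤M in
  squeeze (partialProduct M) ε (tolerance j) (partialProduct-positive M) 0<ε tolerance≤ε² upper lower
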